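{- Let $D=(D_1,\dots,D_L)$ be a sequence of real numbers and let $1\le i,j\le L$. Assume $a\in B(i)\cap B(j)$ and let $b\ge a$. Then $b\in B(i)$ if and only if $b\in B(j)$.
   Context: For a sequence $F$ of reals and $1\le s\le t\le |F|$ write $\bar F(s,t)$ for the average of $F_s,\dots,F_t$. An index $1\le k\le |F|$ is a border of $F$ if there is a (possibly empty) sequence $E$ such that, with $G$ the concatenation of $F$ and $E$, $\bar G(k,|G|)=\max_{1\le s\le |G|}\bar G(s,|G|)$. For $1\le i\le L$, $B(i)$ denotes the set of indices $b$ with $i\le b\le L$ such that $b-i+1$ is a border of the sequence $(D_i,\dots,D_L)$ (i.e. the borders of $D[i,L]$ expressed as indices of $D$). -}

module Defs where

open import Level using (Level; _⊔_) renaming (suc to lsuc)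
open import Data.Nat as ℕ using (ℕ; zero; suc; _∸_)
open import Data.List using (List; length; drop; _++_; foldr)
open import Data.Product using (Σ; ∃; _×_)
open import Relation.Nullary using (¬_)
open import Relation.Binary.Core using (Rel)
open import Relation.Binary.Structures using (IsTotalOrder)
open import Algebra.Bundles using (CommutativeRing)

module _ {c ℓ : Level} (R : CommutativeRing c ℓ) where
  open CommutativeRing R
  ringℕ : ℕ → Carrier
  ringℕ zero    = 0#
  ringℕ (suc n) = 1# + ringℕ n

-- Besides the ordered-field
-- axioms we carry the operation "divide by a positive integer" used to form
-- averages; in a field it is uniquely determined by its specification.
record OrderedField (c ℓ : Level) : Set (lsuc (c ⊔ ℓ)) where
  field
    commutativeRing : CommutativeRing c ℓ
  open CommutativeRing commutativeRing public
  field
    _≤_          : Rel Carrier ℓ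
    isTotalOrder : IsTotalOrder _≈_ _≤_
    +-mono-≤     : ∀ {x y} z → x ≤ y → (x + z) ≤ (y + z)
    *-nonneg     : ∀ {x y} → 0# ≤ x → 0# ≤ y → 0# ≤ (x * y)
    0≉1          : ¬ (0# ≈ 1#)
    inverse      : ∀ x → ¬ (x ≈ 0#) → ∃ λ y → (x * y) ≈ 1#
    -- x /suc n  is  x / (n + 1)
    _/suc_       : Carrier → ℕ → Carrier
    /suc-spec    : ∀ x n → (ringℕ commutativeRing (suc n) * (x /suc n)) ≈ x

module _ {c ℓ : Level} (K : OrderedField c ℓ) where
  open OrderedField K

  sumK : List Carrier → Carrier
  sumK = foldr _+_ 0#

  -- For a sequence G (indices 1..|G|) and 1 ≤ s ≤ |G|:
  -- avgSuffix G s = Ḡ(s, |G|) = (G_s + … + G_|G|) / (|G| - s + 1).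
  avgSuffix : List Carrier → ℕ → Carrier
  avgSuffix G s = sumK (drop (s ∸ 1) G) /suc (length G ∸ s)

  IsBorder : List Carrier → ℕ → Set (c ⊔ ℓ)
  IsBorder F k =
    (1 ℕ.≤ k) × (k ℕ.≤ length F) ×
    Σ (List Carrier) λ E →
      ∀ s → 1 ℕ.≤ s → s ℕ.≤ length (F ++ E) →
        avgSuffix (F ++ E) s ≤ avgSuffix (F ++ E) k

  -- b ∈ B(i) for the sequence D = (D_1,…,D_L):
  -- i ≤ b ≤ L and b - i + 1 is a border of D[i,L] = (D_i,…,D_L).
  InB : List Carrier → ℕ → ℕ → Set (c ⊔ ℓ)
  InB D i b = (i ℕ.≤ b) × (b ℕ.≤ length D) × IsBorder (drop (i ∸ 1) D) (suc b ∸ i)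

module Submission where

-- Working with 0-based positions, b+1 ∈ B(i+1) says: b < |D| and for some
-- extension H = D ++ E the suffix of H starting at b has maximal average
-- among all suffixes starting at a position in [i, |H|)  (BorderAt D i b).
-- After translating the definition of B(i) into this form (InB⇔BorderAt),
-- take i ≤ j.  "b ∈ B(i) ⇒ b ∈ B(j)" only shrinks the range of competing
-- suffixes (borderAt-restrict).  For the converse with a < b, a suffix
-- starting at q ≥ a is handled by b ∈ B(j); one starting at q < a is split
-- as U ++ V ++ (suffix at b) with U = D[q,a), V = D[a,b), and the mediant
-- inequalities for averages of concatenations, applied in both extensions
-- (splice), show that its average is at most that of the suffix at b.

open import Defs
open import Level using (Level; _⊔_)
open import Data.Nat using (ℕ; zero; suc; _≤_; _<_; _∸_; z≤n; s≤s)
open import Data.Nat.Properties using (≤-trans; <⇒≤; <-trans; ≤-total; _≤?_; ≰⇒>)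
open import Data.List using (List; []; _∷_; length; _++_; drop; take)
open import Data.Product using (Σ; _×_; _,_; proj₁)
open import Data.Sum using (inj₁; inj₂)
open import Function.Bundles using (_⇔_; mk⇔; Equivalence)
open import Function.Construct.Composition using (_⇔-∘_)
open import Function.Construct.Symmetry using (⇔-sym)
open import Relation.Nullary using (¬_; yes; no)
import Relation.Binary.PropositionalEquality as ≡
open ≡ using (_≡_)
open import Relation.Binary.Structures using (IsTotalOrder)

module ListLemmas {a : Level} {A : Set a} where
  open import Data.Nat using (_+_)

  segment : List A → ℕ → ℕ → List A
  segment xs p r = take (r ∸ p) (drop p xs)

  drop-++ˡ : ∀ {n} (xs ys : List A) → n ≤ length xs → drop n (xs ++ ys) ≡ drop n xs ++ ys
  drop-++ˡ {zero}  xs       ys _        = ≡.refl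
  drop-++ˡ {suc n} (x ∷ xs) ys (s≤s n≤) = drop-++ˡ xs ys n≤

  drop-++-segment : ∀ {p r} (xs ys : List A) → p ≤ r → r ≤ length xs →
                    drop p (xs ++ ys) ≡ segment xs p r ++ drop r (xs ++ ys)
  drop-++-segment {zero}  {zero}  xs       ys _         _        = ≡.refl
  drop-++-segment {zero}  {suc r} (x ∷ xs) ys _         (s≤s r≤) =
    ≡.cong (x ∷_) (drop-++-segment xs ys z≤n r≤)
  drop-++-segment {suc p} {suc r} (x ∷ xs) ys (s≤s p≤r) (s≤s r≤) = drop-++-segment xs ys p≤r r≤

  -- Nonemptiness facts, needed because averages are only taken of nonempty lists.
  segment-nonempty : ∀ {p r} (xs : List A) → p < r → r ≤ length xs → 1 ≤ length (segment xs p r)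
  segment-nonempty {zero}  {suc r} (x ∷ xs) _         _        = s≤s z≤n
  segment-nonempty {suc p} {suc r} (x ∷ xs) (s≤s p<r) (s≤s r≤) = segment-nonempty xs p<r r≤

  drop-nonempty : ∀ {r} (xs ys : List A) → r < length xs → 1 ≤ length (drop r (xs ++ ys))
  drop-nonempty {zero}  (x ∷ xs) ys _        = s≤s z≤n
  drop-nonempty {suc r} (x ∷ xs) ys (s≤s r<) = drop-nonempty xs ys r<

  ++-nonempty : ∀ (xs ys : List A) → 1 ≤ length xs → 1 ≤ length (xs ++ ys)
  ++-nonempty (x ∷ xs) ys _ = s≤s z≤n

  index-++ : ∀ {n} (xs ys : List A) → n < length xs → n < length (xs ++ ys)
  index-++ {zero}  (x ∷ xs) ys _        = s≤s z≤n
  index-++ {suc n} (x ∷ xs) ys (s≤s n<) = s≤s (index-++ xs ys n<)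

  index-drop : ∀ {i q} (H : List A) → i ≤ q → q < length H → q ∸ i < length (drop i H)
  index-drop {zero}  {q}     H        _         q<       = q<
  index-drop {suc i} {suc q} (x ∷ H) (s≤s i≤q) (s≤s q<) = index-drop H i≤q q<

  drop-index : ∀ {i t} (H : List A) → t < length (drop i H) → i + t < length H
  drop-index {zero}  H       t< = t<
  drop-index {suc i} (x ∷ H) t< = s≤s (drop-index H t<)

open ListLemmas

module OrderedFieldProperties {c ℓ : Level} (K : OrderedField c ℓ) where
  open OrderedField K renaming (_≤_ to _≤ᴷ_)
  open IsTotalOrder isTotalOrder using (isPartialOrder; antisym; total)
    renaming (trans to ≤ᴷ-trans; reflexive to ≤ᴷ-reflexive)
  open import Algebra.Properties.Ring ring using (-1*x≈-x)
  open import Algebra.Properties.Group +-group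
    using (⁻¹-involutive; //-rightDividesˡ; //-rightDividesʳ)
  open import Relation.Binary.Bundles using (Poset)
  import Relation.Binary.Reasoning.PartialOrder as PartialOrderReasoning
  import Relation.Binary.Reasoning.Setoid as SetoidReasoning

  poset : Poset c ℓ ℓ
  poset = record { isPartialOrder = isPartialOrder }

  module ≤-Reasoning = PartialOrderReasoning poset
  module ≈-Reasoning = SetoidReasoning setoid

  +-mono-≤₂ : ∀ {x y u v} → x ≤ᴷ y → u ≤ᴷ v → (x + u) ≤ᴷ (y + v)
  +-mono-≤₂ {x} {y} {u} {v} x≤y u≤v = begin
    x + u ≤⟨ +-mono-≤ u x≤y ⟩
    y + u ≈⟨ +-comm y u ⟩
    u + y ≤⟨ +-mono-≤ y u≤v ⟩
    v + y ≈⟨ +-comm v y ⟩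
    y + v ∎
    where open ≤-Reasoning

  +-cancelʳ-≤ : ∀ {x y} z → (x + z) ≤ᴷ (y + z) → x ≤ᴷ y
  +-cancelʳ-≤ {x} {y} z le = begin
    x               ≈⟨ //-rightDividesʳ z x ⟨
    (x + z) + (- z) ≤⟨ +-mono-≤ (- z) le ⟩
    (y + z) + (- z) ≈⟨ //-rightDividesʳ z y ⟩
    y ∎
    where open ≤-Reasoning

  0≤-difference : ∀ {x y} → x ≤ᴷ y → 0# ≤ᴷ (y + (- x))
  0≤-difference {x} {y} x≤y = begin
    0#       ≈⟨ -‿inverseʳ x ⟨
    x + (- x) ≤⟨ +-mono-≤ (- x) x≤y ⟩
    y + (- x) ∎
    where open ≤-Reasoning

  -- Either 0 ≤ 1 directly, or 1 ≤ 0 gives 0 ≤ -1 and then 0 ≤ (-1)·(-1) = 1.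
  0≤1 : 0# ≤ᴷ 1#
  0≤1 with total 0# 1#
  ... | inj₁ 0≤1 = 0≤1
  ... | inj₂ 1≤0 = begin
    0#              ≤⟨ *-nonneg 0≤-1 0≤-1 ⟩
    (- 1#) * (- 1#) ≈⟨ -1*x≈-x (- 1#) ⟩
    - (- 1#)        ≈⟨ ⁻¹-involutive 1# ⟩
    1# ∎
    where
    open ≤-Reasoning
    0≤-1 : 0# ≤ᴷ (- 1#)
    0≤-1 = ≤ᴷ-trans (0≤-difference 1≤0) (≤ᴷ-reflexive (+-identityˡ (- 1#)))

  ringℕ-nonneg : ∀ n → 0# ≤ᴷ ringℕ commutativeRing n
  ringℕ-nonneg zero    = ≤ᴷ-reflexive refl
  ringℕ-nonneg (suc n) = ≤ᴷ-trans (≤ᴷ-reflexive (sym (+-identityʳ 0#)))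
                                   (+-mono-≤₂ 0≤1 (ringℕ-nonneg n))

  -- Positive integers are nonzero: 1 + n = 0 would force 1 ≤ 0 ≤ 1.
  ringℕ-suc≉0 : ∀ n → ¬ (ringℕ commutativeRing (suc n) ≈ 0#)
  ringℕ-suc≉0 n 1+n≈0 = 0≉1 (antisym 0≤1 1≤0)
    where
    open ≤-Reasoning
    1≤0 : 1# ≤ᴷ 0#
    1≤0 = begin
      1#                           ≈⟨ +-identityʳ 1# ⟨
      1# + 0#                      ≤⟨ +-mono-≤₂ (≤ᴷ-reflexive refl) (ringℕ-nonneg n) ⟩
      1# + ringℕ commutativeRing n ≈⟨ 1+n≈0 ⟩
      0# ∎

  -- Multiplication by a nonnegative element is monotone: z·y - z·x = z·(y - x) ≥ 0.
  *-monoˡ-≤ : ∀ {z x y} → 0# ≤ᴷ z → x ≤ᴷ y → (z * x) ≤ᴷ (z * y)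
  *-monoˡ-≤ {z} {x} {y} 0≤z x≤y = begin
    z * x                   ≈⟨ +-identityˡ (z * x) ⟨
    0# + z * x              ≤⟨ +-mono-≤ (z * x) (*-nonneg 0≤z (0≤-difference x≤y)) ⟩
    z * (y + (- x)) + z * x ≈⟨ distribˡ z (y + (- x)) x ⟨
    z * ((y + (- x)) + x)   ≈⟨ *-congˡ (//-rightDividesˡ x y) ⟩
    z * y ∎
    where open ≤-Reasoning

  *-cancelˡ-≈ : ∀ {z x y} → ¬ (z ≈ 0#) → (z * x) ≈ (z * y) → x ≈ y
  *-cancelˡ-≈ {z} {x} {y} z≉0 zx≈zy with inverse z z≉0
  ... | w , zw≈1 = begin
    x            ≈⟨ *-identityˡ x ⟨
    1# * x       ≈⟨ *-congʳ (trans (sym zw≈1) (*-comm z w)) ⟩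
    (w * z) * x  ≈⟨ *-assoc w z x ⟩
    w * (z * x)  ≈⟨ *-congˡ zx≈zy ⟩
    w * (z * y)  ≈⟨ *-assoc w z y ⟨
    (w * z) * y  ≈⟨ *-congʳ (trans (*-comm w z) zw≈1) ⟩
    1# * y       ≈⟨ *-identityˡ y ⟩
    y ∎
    where open ≈-Reasoning

  -- By totality, x ≤ y or y ≤ x; in the latter case z·x = z·y, hence x = y.
  *-cancelˡ-≤ : ∀ {z x y} → 0# ≤ᴷ z → ¬ (z ≈ 0#) → (z * x) ≤ᴷ (z * y) → x ≤ᴷ y
  *-cancelˡ-≤ {z} {x} {y} 0≤z z≉0 zx≤zy with total x y
  ... | inj₁ x≤y = x≤y
  ... | inj₂ y≤x = ≤ᴷ-reflexive (*-cancelˡ-≈ z≉0 (antisym zx≤zy (*-monoˡ-≤ 0≤z y≤x)))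

module Averages {c ℓ : Level} (K : OrderedField c ℓ) where
  open OrderedField K renaming (_≤_ to _≤ᴷ_)
  open IsTotalOrder isTotalOrder using () renaming (trans to ≤ᴷ-trans; reflexive to ≤ᴷ-reflexive)
  open OrderedFieldProperties K

  count : List Carrier → Carrier
  count xs = ringℕ commutativeRing (length xs)

  -- The average of a list, meaningful when it is nonempty; avgSuffix G (suc t) = av (drop t G).
  av : List Carrier → Carrier
  av xs = sumK K xs /suc (length xs ∸ 1)

  count*av : ∀ xs → 1 ≤ length xs → (count xs * av xs) ≈ sumK K xs
  count*av (x ∷ xs) _ = /suc-spec (sumK K (x ∷ xs)) (length xs)

  count≉0 : ∀ xs → 1 ≤ length xs → ¬ (count xs ≈ 0#)
  count≉0 (x ∷ xs) _ = ringℕ-suc≉0 (length xs)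

  sum-++ : ∀ U V → sumK K (U ++ V) ≈ (sumK K U + sumK K V)
  sum-++ []      V = sym (+-identityˡ _)
  sum-++ (u ∷ U) V = trans (+-congˡ (sum-++ U V)) (sym (+-assoc _ _ _))

  count-++ : ∀ U V → count (U ++ V) ≈ (count U + count V)
  count-++ []      V = sym (+-identityˡ _)
  count-++ (u ∷ U) V = trans (+-congˡ (count-++ U V)) (sym (+-assoc _ _ _))

  count-++-* : ∀ U V x → (count (U ++ V) * x) ≈ (count U * x + count V * x)
  count-++-* U V x = trans (*-congʳ (count-++ U V)) (distribʳ x (count U) (count V))

  av≤⇒sum≤ : ∀ xs {x} → 1 ≤ length xs → av xs ≤ᴷ x → sumK K xs ≤ᴷ (count xs * x)
  av≤⇒sum≤ xs {x} ne av≤x = begin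
    sumK K xs        ≈⟨ count*av xs ne ⟨
    count xs * av xs ≤⟨ *-monoˡ-≤ (ringℕ-nonneg (length xs)) av≤x ⟩
    count xs * x ∎
    where open ≤-Reasoning

  sum≤⇒av≤ : ∀ xs {x} → 1 ≤ length xs → sumK K xs ≤ᴷ (count xs * x) → av xs ≤ᴷ x
  sum≤⇒av≤ xs ne sum≤ =
    *-cancelˡ-≤ (ringℕ-nonneg (length xs)) (count≉0 xs ne) (≤ᴷ-trans (≤ᴷ-reflexive (count*av xs ne)) sum≤)

  ≤sum⇒≤av : ∀ xs {x} → 1 ≤ length xs → (count xs * x) ≤ᴷ sumK K xs → x ≤ᴷ av xs
  ≤sum⇒≤av xs ne ≤sum =
    *-cancelˡ-≤ (ringℕ-nonneg (length xs)) (count≉0 xs ne) (≤ᴷ-trans ≤sum (≤ᴷ-reflexive (sym (count*av xs ne))))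

  av-++-≤ : ∀ U V {x} → 1 ≤ length U → 1 ≤ length V → av U ≤ᴷ x → av V ≤ᴷ x → av (U ++ V) ≤ᴷ x
  av-++-≤ U V {x} neU neV U≤x V≤x = sum≤⇒av≤ (U ++ V) (++-nonempty U V neU) (begin
    sumK K (U ++ V)           ≈⟨ sum-++ U V ⟩
    sumK K U + sumK K V       ≤⟨ +-mono-≤₂ (av≤⇒sum≤ U neU U≤x) (av≤⇒sum≤ V neV V≤x) ⟩
    count U * x + count V * x ≈⟨ count-++-* U V x ⟨
    count (U ++ V) * x ∎)
    where open ≤-Reasoning

  av-prefix-≤ : ∀ U V → 1 ≤ length U → 1 ≤ length V → av (U ++ V) ≤ᴷ av V → av U ≤ᴷ av V
  av-prefix-≤ U V neU neV UV≤V = sum≤⇒av≤ U neU (+-cancelʳ-≤ (sumK K V) (begin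
    sumK K U + sumK K V             ≈⟨ sum-++ U V ⟨
    sumK K (U ++ V)                 ≤⟨ av≤⇒sum≤ (U ++ V) (++-nonempty U V neU) UV≤V ⟩
    count (U ++ V) * av V           ≈⟨ count-++-* U V (av V) ⟩
    count U * av V + count V * av V ≈⟨ +-congˡ (count*av V neV) ⟩
    count U * av V + sumK K V ∎))
    where open ≤-Reasoning

  av-prefix-≥ : ∀ U V → 1 ≤ length U → 1 ≤ length V → av V ≤ᴷ av (U ++ V) → av (U ++ V) ≤ᴷ av U
  av-prefix-≥ U V neU neV V≤UV = ≤sum⇒≤av U neU (+-cancelʳ-≤ (sumK K V) (begin
    count U * y + sumK K V    ≤⟨ +-mono-≤₂ (≤ᴷ-reflexive refl) (av≤⇒sum≤ V neV V≤UV) ⟩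
    count U * y + count V * y ≈⟨ count-++-* U V y ⟨
    count (U ++ V) * y        ≈⟨ count*av (U ++ V) (++-nonempty U V neU) ⟩
    sumK K (U ++ V)           ≈⟨ sum-++ U V ⟩
    sumK K U + sumK K V ∎))
    where
    open ≤-Reasoning
    y : Carrier
    y = av (U ++ V)

  splice : ∀ U V A B → 1 ≤ length U → 1 ≤ length V → 1 ≤ length A → 1 ≤ length B →
           av (U ++ (V ++ A)) ≤ᴷ av (V ++ A) → av A ≤ᴷ av (V ++ A) → av (V ++ B) ≤ᴷ av B →
           av (U ++ (V ++ B)) ≤ᴷ av B
  splice U V A B neU neV neA neB UVA≤VA A≤VA VB≤B =
    av-++-≤ U (V ++ B) neU (++-nonempty V B neV) (≤ᴷ-trans U≤VA (≤ᴷ-trans VA≤V V≤B)) VB≤B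
    where
    U≤VA : av U ≤ᴷ av (V ++ A)
    U≤VA = av-prefix-≤ U (V ++ A) neU (++-nonempty V A neV) UVA≤VA
    VA≤V : av (V ++ A) ≤ᴷ av V
    VA≤V = av-prefix-≥ V A neV neA A≤VA
    V≤B : av V ≤ᴷ av B
    V≤B = av-prefix-≤ V B neV neB VB≤B

module Borders {c ℓ : Level} (K : OrderedField c ℓ) where
  open OrderedField K using (Carrier) renaming (_≤_ to _≤ᴷ_)
  open Averages K using (av; splice)
  open import Data.Nat using (_+_)
  open import Data.Nat.Properties using (m≤m+n; m+[n∸m]≡n; +-∸-assoc; ∸-monoˡ-≤; m<n⇒0<n∸m; m≤n⇒m<n∨m≡n)
  open import Data.List.Properties using (length-drop; drop-drop)

  avgSuffix-suc : ∀ (G : List Carrier) t → avgSuffix K G (suc t) ≡ av (drop t G)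
  avgSuffix-suc G       zero    = ≡.refl
  avgSuffix-suc []      (suc t) = ≡.refl
  avgSuffix-suc (x ∷ G) (suc t) = avgSuffix-suc G t

  avgSuffix-drop : ∀ (H : List Carrier) i t → avgSuffix K (drop i H) (suc t) ≡ av (drop (i + t) H)
  avgSuffix-drop H i t = ≡.trans (avgSuffix-suc (drop i H) t) (≡.cong av (drop-drop i t H))

  MaxAt : List Carrier → ℕ → Set ℓ
  MaxAt G k = ∀ s → 1 ≤ s → s ≤ length G → avgSuffix K G s ≤ᴷ avgSuffix K G k

  SuffixMaxFrom : List Carrier → ℕ → ℕ → Set ℓ
  SuffixMaxFrom H i b = ∀ q → i ≤ q → q < length H → av (drop q H) ≤ᴷ av (drop b H)

  maxAt⇔suffixMaxFrom : ∀ (H : List Carrier) {i b} → i ≤ b →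
                        MaxAt (drop i H) (suc b ∸ i) ⇔ SuffixMaxFrom H i b
  maxAt⇔suffixMaxFrom H {i} {b} i≤b = mk⇔ to from
    where
    atPosition : ∀ {q} → i ≤ q → avgSuffix K (drop i H) (suc (q ∸ i)) ≡ av (drop q H)
    atPosition {q} i≤q = ≡.trans (avgSuffix-drop H i (q ∸ i)) (≡.cong (λ n → av (drop n H)) (m+[n∸m]≡n i≤q))
    atB : avgSuffix K (drop i H) (suc b ∸ i) ≡ av (drop b H)
    atB = ≡.trans (≡.cong (avgSuffix K (drop i H)) (+-∸-assoc 1 i≤b)) (atPosition i≤b)
    to : MaxAt (drop i H) (suc b ∸ i) → SuffixMaxFrom H i b
    to max q i≤q q<H = ≡.subst₂ _≤ᴷ_ (atPosition i≤q) atB (max (suc (q ∸ i)) (s≤s z≤n) (index-drop H i≤q q<H))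
    from : SuffixMaxFrom H i b → MaxAt (drop i H) (suc b ∸ i)
    from max (suc t) _ t< =
      ≡.subst₂ _≤ᴷ_ (≡.sym (avgSuffix-drop H i t)) (≡.sym atB) (max (i + t) (m≤m+n i t) (drop-index H t<))

  BorderAt : List Carrier → ℕ → ℕ → Set (c ⊔ ℓ)
  BorderAt D i b = (i ≤ b) × (b < length D) × Σ (List Carrier) λ E → SuffixMaxFrom (D ++ E) i b

  InB⇔BorderAt : ∀ (D : List Carrier) {i b} → InB K D (suc i) (suc b) ⇔ BorderAt D i b
  InB⇔BorderAt D {i} {b} = mk⇔ to from
    where
    shift : ∀ E → i ≤ b → b < length D → drop i D ++ E ≡ drop i (D ++ E)
    shift E i≤b b<D = ≡.sym (drop-++ˡ D E (≤-trans i≤b (<⇒≤ b<D)))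
    to : InB K D (suc i) (suc b) → BorderAt D i b
    to (s≤s i≤b , b<D , _ , _ , E , max) = i≤b , b<D , E ,
      Equivalence.to (maxAt⇔suffixMaxFrom (D ++ E) i≤b)
        (≡.subst (λ G → MaxAt G (suc b ∸ i)) (shift E i≤b b<D) max)
    from : BorderAt D i b → InB K D (suc i) (suc b)
    from (i≤b , b<D , E , max) =
      s≤s i≤b , b<D , m<n⇒0<n∸m (s≤s i≤b) ,
      ≡.subst (suc b ∸ i ≤_) (≡.sym (length-drop i D)) (∸-monoˡ-≤ i b<D) , E ,
      ≡.subst (λ G → MaxAt G (suc b ∸ i)) (≡.sym (shift E i≤b b<D))
        (Equivalence.from (maxAt⇔suffixMaxFrom (D ++ E) i≤b) max)

  borderAt-restrict : ∀ {D i j b} → i ≤ j → j ≤ b → BorderAt D i b → BorderAt D j b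
  borderAt-restrict i≤j j≤b (_ , b<D , E , max) = j≤b , b<D , E , λ q j≤q → max q (≤-trans i≤j j≤q)

  suffix-before : ∀ D Ea Eb {i j q a b} → SuffixMaxFrom (D ++ Ea) i a → SuffixMaxFrom (D ++ Eb) j b →
                  i ≤ q → q < a → j ≤ a → a < b → b < length D →
                  av (drop q (D ++ Eb)) ≤ᴷ av (drop b (D ++ Eb))
  suffix-before D Ea Eb {q = q} {a = a} {b = b} maxA maxB i≤q q<a j≤a a<b b<D =
    ≡.subst (λ xs → av xs ≤ᴷ av (drop b (D ++ Eb))) (≡.sym (splitQ Eb))
      (splice U V (drop b (D ++ Ea)) (drop b (D ++ Eb)) (segment-nonempty D q<a (<⇒≤ a<D)) (segment-nonempty D a<b (<⇒≤ b<D))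
              (drop-nonempty D Ea b<D) (drop-nonempty D Eb b<D) Q≤A B≤A A≤B)
    where
    a<D : a < length D
    a<D = <-trans a<b b<D
    U V : List Carrier
    U = segment D q a
    V = segment D a b
    splitA : ∀ E → drop a (D ++ E) ≡ V ++ drop b (D ++ E)
    splitA E = drop-++-segment D E (<⇒≤ a<b) (<⇒≤ b<D)
    splitQ : ∀ E → drop q (D ++ E) ≡ U ++ (V ++ drop b (D ++ E))
    splitQ E = ≡.trans (drop-++-segment D E (<⇒≤ q<a) (<⇒≤ a<D)) (≡.cong (U ++_) (splitA E))
    Q≤A : av (U ++ (V ++ drop b (D ++ Ea))) ≤ᴷ av (V ++ drop b (D ++ Ea))
    Q≤A = ≡.subst₂ (λ xs ys → av xs ≤ᴷ av ys) (splitQ Ea) (splitA Ea)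
            (maxA q i≤q (index-++ D Ea (<-trans q<a a<D)))
    B≤A : av (drop b (D ++ Ea)) ≤ᴷ av (V ++ drop b (D ++ Ea))
    B≤A = ≡.subst (λ ys → av (drop b (D ++ Ea)) ≤ᴷ av ys) (splitA Ea)
            (maxA b (≤-trans i≤q (<⇒≤ (<-trans q<a a<b))) (index-++ D Ea b<D))
    A≤B : av (V ++ drop b (D ++ Eb)) ≤ᴷ av (drop b (D ++ Eb))
    A≤B = ≡.subst (λ xs → av xs ≤ᴷ av (drop b (D ++ Eb))) (splitA Eb) (maxB a j≤a (index-++ D Eb a<D))

  borderAt-extend : ∀ {D i j a b} → BorderAt D i a → j ≤ a → a < b → BorderAt D j b → BorderAt D i b
  borderAt-extend {D} {i} {a = a} {b = b} (i≤a , _ , Ea , maxA) j≤a a<b (_ , b<D , Eb , maxB) =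
    ≤-trans i≤a (<⇒≤ a<b) , b<D , Eb , maxI
    where
    maxI : SuffixMaxFrom (D ++ Eb) i b
    maxI q i≤q q<H with a ≤? q
    ... | yes a≤q = maxB q (≤-trans j≤a a≤q) q<H
    ... | no  a≰q = suffix-before D Ea Eb maxA maxB i≤q (≰⇒> a≰q) j≤a a<b b<D

  borderAt-nested : ∀ {D i j a b} → i ≤ j → BorderAt D i a → BorderAt D j a → a ≤ b →
                    BorderAt D i b ⇔ BorderAt D j b
  borderAt-nested {D} {i} {j} {a} {b} i≤j a∈Bi a∈Bj a≤b =
    mk⇔ (borderAt-restrict i≤j (≤-trans j≤a a≤b)) backward
    where
    j≤a : j ≤ a
    j≤a = proj₁ a∈Bj
    backward : BorderAt D j b → BorderAt D i b
    backward b∈Bj with m≤n⇒m<n∨m≡n a≤b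
    ... | inj₁ a<b    = borderAt-extend a∈Bi j≤a a<b b∈Bj
    ... | inj₂ ≡.refl = a∈Bi

  InB-nested : ∀ (D : List Carrier) {i j a b} → i ≤ j →
               InB K D (suc i) (suc a) → InB K D (suc j) (suc a) → a ≤ b →
               InB K D (suc i) (suc b) ⇔ InB K D (suc j) (suc b)
  InB-nested D {a = a} i≤j a∈Bi a∈Bj a≤b =
    ⇔-sym (InB⇔BorderAt D) ⇔-∘ (borderAt-nested i≤j (toBorder a∈Bi) (toBorder a∈Bj) a≤b ⇔-∘ InB⇔BorderAt D)
    where
    toBorder : ∀ {k} → InB K D (suc k) (suc a) → BorderAt D k a
    toBorder = Equivalence.to (InB⇔BorderAt D)

theorem6 : {c ℓ : Level} (K : OrderedField c ℓ) (D : List (OrderedField.Carrier K))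
    (i j a b : ℕ) → 1 ≤ i → i ≤ length D → 1 ≤ j → j ≤ length D →
    InB K D i a → InB K D j a → a ≤ b →
    (InB K D i b ⇔ InB K D j b)
theorem6 K D (suc i) (suc j) (suc a) (suc b) _ _ _ _ a∈Bi a∈Bj (s≤s a≤b) with ≤-total i j
... | inj₁ i≤j = Borders.InB-nested K D i≤j a∈Bi a∈Bj a≤b
... | inj₂ j≤i = ⇔-sym (Borders.InB-nested K D j≤i a∈Bj a∈Bi a≤b)
theorem6 K D (suc i) j       zero    b       _ _ _ _ (() , _) _ _
theorem6 K D (suc i) j       (suc a) zero    _ _ _ _ _ _ ()
theorem6 K D (suc i) zero    (suc a) (suc b) _ _ () _ _ _ _
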